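{- Let $G=(V,\mathcal D,\ell_v)$ and $G'=(V',\mathcal D',\ell'_v)$ be finite node-labeled digraphs that are weakly connected, simple, oriented and transitively closed. If $(U,\phi)$ is a feasible solution with $\mathcal P(U,\phi)=\operatorname{DMCES}(G,G')$, then $(U,\phi)$ respects order on labels, i.e. there are no $u,v\in U$ with $\ell_v(u)=\ell_v(v)$, $(v,u)\in\mathcal D$ and $(\phi(u),\phi(v))\in\mathcal D'$.
   Context: A node-labeled digraph $G=(V,\mathcal D,\ell_v)$ consists of a finite node set $V$, directed edges $\mathcal D\subseteq V\times V$, and a node-labeling function $\ell_v$ on $V$. Weakly connected: underlying undirected graph connected. Simple: no self-loops and no parallel edges with the same source and target. Oriented: no pair $(a,b),(b,a)$ both in $\mathcal D$. Transitively closed: whenever $(a,b),(b,c)\in\mathcal D$ with $a\neq c$, also $(a,c)\in\mathcal D$. A feasible solution is a pair $(U,\phi)$ with $U\subseteq V$ and $\phi:U\to V'$ injective with $\ell'_v(\phi(x))=\ell_v(x)$ for all $x\in U$; its score is $\mathcal P(U,\phi)=|\{(v_1,v_2)\in U\times U:(v_1,v_2)\in\mathcal D,\ (\phi(v_1),\phi(v_2))\in\mathcal D'\}|$; $\operatorname{DMCES}(G,G')$ is the maximum score over all feasible solutions. -}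

module Defs where

open import Data.Nat using (ℕ; _+_; _≤_)
open import Data.Bool using (Bool; true; false; _∧_; if_then_else_; T)
open import Data.Fin using (Fin)
open import Data.Fin.Subset using (Subset; _∈_)
open import Data.Vec using (lookup)
open import Data.List using (List; map; allFin)
open import Data.Nat.ListAction using (sum)
open import Data.Sum using (_⊎_)
open import Data.Product using (_×_; ∃; ∃-syntax)
open import Relation.Nullary using (¬_)
open import Relation.Binary.PropositionalEquality using (_≡_; _≢_)
open import Relation.Binary.Construct.Closure.ReflexiveTransitive using (Star)

record LDigraph (L : Set) : Set where
  field
    size  : ℕ
    edge  : Fin size → Fin size → Bool
    label : Fin size → L
open LDigraph public

module _ {L : Set} (G : LDigraph L) where

  Edge : Fin (size G) → Fin (size G) → Set
  Edge a b = T (edge G a b)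

  UEdge : Fin (size G) → Fin (size G) → Set
  UEdge a b = Edge a b ⊎ Edge b a

  WeaklyConnected : Set
  WeaklyConnected = ∀ a b → Star UEdge a b

  -- no self-loops (no parallel edges is automatic in this representation)
  Simple : Set
  Simple = ∀ a → ¬ Edge a a

  Oriented : Set
  Oriented = ∀ a b → Edge a b → ¬ Edge b a

  TransitivelyClosed : Set
  TransitivelyClosed = ∀ a b c → Edge a b → Edge b c → a ≢ c → Edge a c

  Nice : Set
  Nice = WeaklyConnected × Simple × Oriented × TransitivelyClosed

module _ {L : Set} (G G' : LDigraph L) where

  -- A feasible solution (U , φ): U ⊆ V, φ : U → V' injective and
  -- label-preserving.  φ is given as a total function on V whose values
  -- outside U are irrelevant.
  Feasible : Subset (size G) → (Fin (size G) → Fin (size G')) → Set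
  Feasible U φ =
    (∀ x y → x ∈ U → y ∈ U → φ x ≡ φ y → x ≡ y) ×
    (∀ x → x ∈ U → label G' (φ x) ≡ label G x)

  score : Subset (size G) → (Fin (size G) → Fin (size G')) → ℕ
  score U φ =
    sum (map (λ v₁ → sum (map (λ v₂ →
      if lookup U v₁ ∧ lookup U v₂ ∧ edge G v₁ v₂ ∧ edge G' (φ v₁) (φ v₂)
      then 1 else 0) (allFin (size G)))) (allFin (size G)))

  Optimal : Subset (size G) → (Fin (size G) → Fin (size G')) → Set
  Optimal U φ = Feasible U φ ×
    (∀ U' φ' → Feasible U' φ' → score U' φ' ≤ score U φ)

  RespectsLabelOrder : Subset (size G) → (Fin (size G) → Fin (size G')) → Set
  RespectsLabelOrder U φ =
    ¬ (∃[ u ] ∃[ v ] (u ∈ U × v ∈ U × label G u ≡ label G v ×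
         Edge G v u × Edge G' (φ u) (φ v)))

-- Suppose u, v ∈ U have equal labels, (v, u) ∈ D and (φ u, φ v) ∈ D'.  Exchanging
-- the images of u and v gives a feasible solution that preserves the edge (v, u).
-- Nothing is lost on the pair {u, v}: orientation forbids (u, v) ∈ D and
-- (φ v, φ u) ∈ D', so no edge between u and v was preserved before.  For any
-- other node w, transitive closure makes (w, v) ∈ D imply (w, u) ∈ D and
-- (φ w, φ u) ∈ D' imply (φ w, φ v) ∈ D', and similarly for edges leaving u and v;
-- the swap then matches the larger indicator with the larger one, which can only
-- increase the count (a 0/1 rearrangement inequality).  So the score strictly
-- increases and (U, φ) was not optimal.
module Submission where

open import Defs
open import Data.Bool using (Bool; true; false; _∧_; if_then_else_; T)
open import Data.Bool.Properties using (T-∧; T-≡)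
open import Data.Empty using (⊥-elim)
open import Data.Fin using (Fin; zero; suc)
open import Data.Fin.Permutation.Components using (transpose; transpose-inverse)
open import Data.Fin.Properties using (_≟_; suc-injective)
open import Data.Fin.Subset using (Subset; _∈_)
open import Data.List using (map; allFin; tabulate)
open import Data.List.Properties using (map-tabulate)
open import Data.Nat using (ℕ; zero; suc; _+_; _≤_; _<_; z≤n)
open import Data.Nat.ListAction using (sum)
open import Data.Nat.Properties
  using ( +-commutativeSemigroup; +-assoc; +-comm; +-mono-≤
        ; ≤-refl; ≤-reflexive; ≤-trans; m≤n+m; m≤m+n; <⇒≱)
open import Algebra.Properties.CommutativeSemigroup +-commutativeSemigroup
  using (interchange; x∙yz≈y∙xz; x∙yz≈xz∙y)
open import Data.Product using (_×_; _,_; proj₁; proj₂)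
open import Data.Unit using (tt)
open import Data.Vec using (lookup)
open import Data.Vec.Properties using (lookup⇒[]=; []=⇒lookup)
open import Function using (_∘_; Equivalence)
open import Relation.Nullary using (¬_; yes; no)
open import Relation.Binary.PropositionalEquality hiding ([_])

∑ : (n : ℕ) → (Fin n → ℕ) → ℕ
∑ n F = sum (map F (allFin n))

∑-suc : ∀ {n} (F : Fin (suc n) → ℕ) → ∑ (suc n) F ≡ F zero + ∑ n (F ∘ suc)
∑-suc F = cong (λ xs → F zero + sum xs)
  (trans (map-tabulate suc F) (sym (map-tabulate (λ i → i) (F ∘ suc))))

∑-+ : ∀ n (F H : Fin n → ℕ) → ∑ n (λ i → F i + H i) ≡ ∑ n F + ∑ n H
∑-+ zero F H = refl
∑-+ (suc n) F H = begin
  ∑ (suc n) (λ i → F i + H i)                    ≡⟨ ∑-suc (λ i → F i + H i) ⟩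
  (F zero + H zero) + ∑ n (λ i → F (suc i) + H (suc i))
                                                 ≡⟨ cong ((F zero + H zero) +_) (∑-+ n (F ∘ suc) (H ∘ suc)) ⟩
  (F zero + H zero) + (∑ n (F ∘ suc) + ∑ n (H ∘ suc))
                                                 ≡⟨ interchange (F zero) (H zero) _ _ ⟩
  (F zero + ∑ n (F ∘ suc)) + (H zero + ∑ n (H ∘ suc))
                                                 ≡⟨ cong₂ _+_ (∑-suc F) (∑-suc H) ⟨
  ∑ (suc n) F + ∑ (suc n) H                      ∎
  where open ≡-Reasoning

∑-mono-≤ : ∀ n {F G : Fin n → ℕ} → (∀ i → F i ≤ G i) → ∑ n F ≤ ∑ n G
∑-mono-≤ zero F≤G = z≤n
∑-mono-≤ (suc n) {F} {G} F≤G rewrite ∑-suc F | ∑-suc G =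
  +-mono-≤ (F≤G zero) (∑-mono-≤ n (F≤G ∘ suc))

∑-≤-except₁ : ∀ {n} {F G : Fin n → ℕ} {k m} (u : Fin n) →
  (∀ i → i ≢ u → F i ≤ G i) → k + F u ≤ m + G u → k + ∑ n F ≤ m + ∑ n G
∑-≤-except₁ {suc n} {F} {G} {k} {m} zero off at-u rewrite ∑-suc F | ∑-suc G =
  subst₂ _≤_ (+-assoc k (F zero) _) (+-assoc m (G zero) _)
    (+-mono-≤ at-u (∑-mono-≤ n (λ i → off (suc i) λ ())))
∑-≤-except₁ {suc n} {F} {G} {k} {m} (suc u) off at-u rewrite ∑-suc F | ∑-suc G =
  subst₂ _≤_ (x∙yz≈y∙xz (F zero) k _) (x∙yz≈y∙xz (G zero) m _)
    (+-mono-≤ (off zero λ ()) (∑-≤-except₁ u (λ i i≢u → off (suc i) (i≢u ∘ suc-injective)) at-u))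

∑-≤-except₂ : ∀ {n} {F G : Fin n → ℕ} {k} (u v : Fin n) → u ≢ v →
  (∀ i → i ≢ u → i ≢ v → F i ≤ G i) → k + (F u + F v) ≤ G u + G v → k + ∑ n F ≤ ∑ n G
∑-≤-except₂ zero zero u≢v _ _ = ⊥-elim (u≢v refl)
∑-≤-except₂ {suc n} {F} {G} {k} zero (suc v) _ off at-uv rewrite ∑-suc F | ∑-suc G =
  subst (_≤ G zero + ∑ n (G ∘ suc)) (+-assoc k (F zero) _)
    (∑-≤-except₁ v (λ i i≢v → off (suc i) (λ ()) (i≢v ∘ suc-injective))
      (subst (_≤ G zero + G (suc v)) (sym (+-assoc k (F zero) _)) at-uv))
∑-≤-except₂ {suc n} {F} {G} {k} (suc u) zero _ off at-uv rewrite ∑-suc F | ∑-suc G =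
  subst (_≤ G zero + ∑ n (G ∘ suc)) (+-assoc k (F zero) _)
    (∑-≤-except₁ u (λ i i≢u → off (suc i) (i≢u ∘ suc-injective) (λ ()))
      (subst₂ _≤_ (x∙yz≈xz∙y k (F (suc u)) (F zero)) (+-comm (G (suc u)) (G zero)) at-uv))
∑-≤-except₂ {suc n} {F} {G} {k} (suc u) (suc v) u≢v off at-uv rewrite ∑-suc F | ∑-suc G =
  subst (_≤ G zero + ∑ n (G ∘ suc)) (x∙yz≈y∙xz (F zero) k _)
    (+-mono-≤ (off zero (λ ()) (λ ()))
      (∑-≤-except₂ u v (u≢v ∘ cong suc)
        (λ i i≢u i≢v → off (suc i) (i≢u ∘ suc-injective) (i≢v ∘ suc-injective)) at-uv))

[_] : Bool → ℕ
[ b ] = if b then 1 else 0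

[]-absent : ∀ {b} → ¬ T b → [ b ] ≡ 0
[]-absent {false} _ = refl
[]-absent {true} ¬b = ⊥-elim (¬b tt)

[]-present : ∀ {b} → T b → [ b ] ≡ 1
[]-present {true} _ = refl

-- (a - b)(c - d) ≥ 0 for 0/1 values with a ≥ b and c ≥ d, guarded by x.
∧-rearrangement : ∀ x a b c d → (T x → T b → T a) → (T x → T d → T c) →
  [ x ∧ a ∧ d ] + [ x ∧ b ∧ c ] ≤ [ x ∧ a ∧ c ] + [ x ∧ b ∧ d ]
∧-rearrangement false a b c d _ _ = z≤n
∧-rearrangement true false false c d _ _ = z≤n
∧-rearrangement true false true c d b⇒a _ = ⊥-elim (b⇒a tt tt)
∧-rearrangement true true true c d _ _ = ≤-reflexive (+-comm [ d ] [ c ])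
∧-rearrangement true true false c false _ _ = z≤n
∧-rearrangement true true false false true _ d⇒c = ⊥-elim (d⇒c tt tt)
∧-rearrangement true true false true true _ _ = ≤-refl

∧-rearrangement′ : ∀ x a b c d → (T x → T a → T b) → (T x → T c → T d) →
  [ x ∧ a ∧ d ] + [ x ∧ b ∧ c ] ≤ [ x ∧ a ∧ c ] + [ x ∧ b ∧ d ]
∧-rearrangement′ x a b c d a⇒b c⇒d =
  subst₂ _≤_ (+-comm [ x ∧ b ∧ c ] [ x ∧ a ∧ d ]) (+-comm [ x ∧ b ∧ d ] [ x ∧ a ∧ c ])
    (∧-rearrangement x b a d c a⇒b c⇒d)

transpose-matchˡ : ∀ {n} (i j : Fin n) → transpose i j i ≡ j
transpose-matchˡ i j with i ≟ i
... | yes _ = refl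
... | no i≢i = ⊥-elim (i≢i refl)

transpose-matchʳ : ∀ {n} (i j : Fin n) → transpose i j j ≡ i
transpose-matchʳ i j with j ≟ i
... | yes j≡i = j≡i
... | no _ with j ≟ j
...   | yes _ = refl
...   | no j≢j = ⊥-elim (j≢j refl)

transpose-other : ∀ {n} {i j k : Fin n} → k ≢ i → k ≢ j → transpose i j k ≡ k
transpose-other {i = i} {j} {k} k≢i k≢j with k ≟ i
... | yes k≡i = ⊥-elim (k≢i k≡i)
... | no _ with k ≟ j
...   | yes k≡j = ⊥-elim (k≢j k≡j)
...   | no _ = refl

transpose-preserves : ∀ {n} {A : Set} (f : Fin n → A) {i j : Fin n} → f i ≡ f j →
  ∀ k → f (transpose i j k) ≡ f k
transpose-preserves f {i} {j} fi≡fj k with k ≟ i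
... | yes refl = sym fi≡fj
... | no _ with k ≟ j
...   | yes refl = fi≡fj
...   | no _ = refl

transpose-injective : ∀ {n} (i j : Fin n) {k l} → transpose i j k ≡ transpose i j l → k ≡ l
transpose-injective i j {k} {l} eq = begin
  k                                 ≡⟨ transpose-inverse j i ⟨
  transpose j i (transpose i j k)   ≡⟨ cong (transpose j i) eq ⟩
  transpose j i (transpose i j l)   ≡⟨ transpose-inverse j i ⟩
  l                                 ∎
  where open ≡-Reasoning

module SwapImproves {L : Set} (G G' : LDigraph L)
  (simple : Simple G) (oriented : Oriented G) (closed : TransitivelyClosed G)
  (oriented' : Oriented G') (closed' : TransitivelyClosed G')
  {U : Subset (size G)} {φ : Fin (size G) → Fin (size G')} (feasible : Feasible G G' U φ)
  {u v : Fin (size G)} (u∈U : u ∈ U) (v∈U : v ∈ U) (same-label : label G u ≡ label G v)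
  (v→u : Edge G v u) (φu→φv : Edge G' (φ u) (φ v)) where

  n : ℕ
  n = size G

  φ-injective : ∀ {x y} → x ∈ U → y ∈ U → φ x ≡ φ y → x ≡ y
  φ-injective {x} {y} = proj₁ feasible x y

  u≢v : u ≢ v
  u≢v refl = simple u v→u

  lookup-u : lookup U u ≡ true
  lookup-u = []=⇒lookup u∈U

  lookup-v : lookup U v ≡ true
  lookup-v = []=⇒lookup v∈U

  τ : Fin n → Fin n
  τ = transpose u v

  ψ : Fin n → Fin (size G')
  ψ = φ ∘ τ

  τ-∈ : ∀ {x} → x ∈ U → τ x ∈ U
  τ-∈ {x} x∈U = lookup⇒[]= (τ x) U
    (trans (transpose-preserves (lookup U) (trans lookup-u (sym lookup-v)) x) ([]=⇒lookup x∈U))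

  ψ-feasible : Feasible G G' U ψ
  ψ-feasible =
      (λ x y x∈U y∈U ψx≡ψy → transpose-injective u v (φ-injective (τ-∈ x∈U) (τ-∈ y∈U) ψx≡ψy))
    , (λ x x∈U → trans (proj₂ feasible (τ x) (τ-∈ x∈U)) (transpose-preserves (label G) same-label x))

  -- With these definitions score G G' U χ is definitionally ∑ n (λ p → ∑ n (pair χ p)).
  preserved : (Fin n → Fin (size G')) → Fin n → Fin n → Bool
  preserved χ p q = lookup U p ∧ lookup U q ∧ edge G p q ∧ edge G' (χ p) (χ q)

  pair : (Fin n → Fin (size G')) → Fin n → Fin n → ℕ
  pair χ p q = [ preserved χ p q ]

  pair-absent : ∀ χ {p q} → ¬ (Edge G p q × Edge G' (χ p) (χ q)) → pair χ p q ≡ 0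
  pair-absent χ {p} {q} ¬edges = []-absent λ t →
    let _ , t₁ = to (T-∧ {lookup U p}) t
        _ , t₂ = to (T-∧ {lookup U q}) t₁
    in ¬edges (to T-∧ t₂)
    where open Equivalence

  pair-present : ∀ χ {p q} → p ∈ U → q ∈ U → Edge G p q → Edge G' (χ p) (χ q) → pair χ p q ≡ 1
  pair-present χ {p} {q} p∈U q∈U e e' = []-present
    (from T-∧ (from T-≡ ([]=⇒lookup p∈U) ,
      from T-∧ (from T-≡ ([]=⇒lookup q∈U) , from T-∧ (e , e'))))
    where open Equivalence

  in-U : ∀ {w} → T (lookup U w) → w ∈ U
  in-U {w} t = lookup⇒[]= w U (Equivalence.to T-≡ t)

  ψv→ψu : Edge G' (ψ v) (ψ u)
  ψv→ψu = subst₂ (Edge G')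
    (cong φ (sym (transpose-matchʳ u v))) (cong φ (sym (transpose-matchˡ u v))) φu→φv

  block : 1 + ((pair φ u u + pair φ v u) + (pair φ u v + pair φ v v))
        ≤ (pair ψ u u + pair ψ v u) + (pair ψ u v + pair ψ v v)
  block
    rewrite pair-absent φ (simple u ∘ proj₁) | pair-absent φ (simple v ∘ proj₁)
          | pair-absent φ (oriented v u v→u ∘ proj₁)
          | pair-absent φ (oriented' (φ u) (φ v) φu→φv ∘ proj₂)
          | pair-present ψ v∈U u∈U v→u ψv→ψu
          = ≤-trans (m≤n+m 1 (pair ψ u u)) (m≤m+n _ _)

  row-≤ : ∀ w → w ≢ u → w ≢ v → ∑ n (pair φ w) ≤ ∑ n (pair ψ w)
  row-≤ w w≢u w≢v = ∑-≤-except₂ {k = 0} u v u≢v off corner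
    where
    off : ∀ q → q ≢ u → q ≢ v → pair φ w q ≤ pair ψ w q
    off q q≢u q≢v rewrite transpose-other w≢u w≢v | transpose-other q≢u q≢v = ≤-refl
    corner : pair φ w u + pair φ w v ≤ pair ψ w u + pair ψ w v
    corner
      rewrite transpose-other w≢u w≢v | transpose-matchˡ u v | transpose-matchʳ u v
            | lookup-u | lookup-v =
      ∧-rearrangement (lookup U w) (edge G w u) (edge G w v)
        (edge G' (φ w) (φ v)) (edge G' (φ w) (φ u))
        (λ _ w→v → closed w v u w→v v→u w≢u)
        (λ w∈U φw→φu → closed' _ _ _ φw→φu φu→φv (w≢v ∘ φ-injective (in-U w∈U) v∈U))

  column-≤ : ∀ w → w ≢ u → w ≢ v → pair φ u w + pair φ v w ≤ pair ψ u w + pair ψ v w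
  column-≤ w w≢u w≢v
    rewrite transpose-other w≢u w≢v | transpose-matchˡ u v | transpose-matchʳ u v
          | lookup-u | lookup-v =
    ∧-rearrangement′ (lookup U w) (edge G u w) (edge G v w)
      (edge G' (φ v) (φ w)) (edge G' (φ u) (φ w))
      (λ _ u→w → closed v u w v→u u→w (w≢v ∘ sym))
      (λ w∈U φv→φw → closed' _ _ _ φu→φv φv→φw (w≢u ∘ sym ∘ φ-injective u∈U (in-U w∈U)))

  rows-uv : 1 + (∑ n (pair φ u) + ∑ n (pair φ v)) ≤ ∑ n (pair ψ u) + ∑ n (pair ψ v)
  rows-uv = subst₂ (λ a b → 1 + a ≤ b)
    (∑-+ n (pair φ u) (pair φ v)) (∑-+ n (pair ψ u) (pair ψ v))
    (∑-≤-except₂ u v u≢v column-≤ block)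

  swap-improves : score G G' U φ < score G G' U ψ
  swap-improves = ∑-≤-except₂ {k = 1} u v u≢v row-≤ rows-uv

theorem8p4 : {L : Set} (G G' : LDigraph L) → Nice G → Nice G' →
    (U : Subset (size G)) (φ : Fin (size G) → Fin (size G')) →
    Optimal G G' U φ → RespectsLabelOrder G G' U φ
theorem8p4 G G' (_ , simple , oriented , closed) (_ , _ , oriented' , closed') U φ
  (feasible , optimal) (u , v , u∈U , v∈U , same-label , v→u , φu→φv) =
  <⇒≱ swap-improves (optimal U ψ ψ-feasible)
  where
  open SwapImproves G G' simple oriented closed oriented' closed' feasible
    u∈U v∈U same-label v→u φu→φv
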